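{- In the Pyro game with one firefighter on the infinite Cartesian grid, the firefighter has a strategy (protecting at each step only vertices at graph distance exactly $48$ from the initially burned vertex) that prevents the pyro from ever burning any vertex at graph distance $48$ from the initially burned vertex; this remains true even if, during each of the steps $t=1,\dots,44$, after the firefighter's move every vertex at distance $t$ from the initially burned vertex becomes burned. In particular, one firefighter can contain the fire.
   Context: The infinite Cartesian grid has vertex set $\mathbb{Z}^2$, with $(x,y)$ adjacent to $(x',y')$ iff $|x-x'|+|y-y'|=1$; distance is graph distance. The Pyro game with $k$ firefighters on a graph: at step $0$ the pyro chooses a vertex and burns it. At each subsequent step, the firefighter player first protects $k$ vertices that are neither burned nor protected, and then the pyro chooses one burned vertex and burns all of its neighbours that are neither protected nor burned. Once a vertex is burned or protected it remains so forever. On an infinite graph, the fire is contained if the firefighter player has a strategy ensuring that, whatever the pyro does, there is some finite step after which no further vertex is burned. -}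

module Defs where

open import Data.Nat using (ℕ; zero; suc; _<_; _≤_; _<ᵇ_)
import Data.Nat as ℕ
open import Data.Integer as ℤ using (ℤ; ∣_∣; _-_)
open import Data.Bool using (Bool; true; false; _∧_; _∨_; not)
open import Data.Product using (_×_; _,_; ∃-syntax)
open import Data.Product.Properties using (≡-dec)
open import Data.Sum using (_⊎_)
open import Data.List using (List; map; upTo)
open import Relation.Nullary using (¬_)
open import Relation.Nullary.Decidable using (⌊_⌋)
open import Relation.Binary.PropositionalEquality using (_≡_)

V : Set
V = ℤ × ℤ

_≟V_ : (u v : V) → Relation.Nullary.Dec (u ≡ v)
_≟V_ = ≡-dec ℤ._≟_ ℤ._≟_

dist : V → V → ℕ
dist (a , b) (c , d) = ∣ a - c ∣ ℕ.+ ∣ b - d ∣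

adjᵇ : V → V → Bool
adjᵇ u v = ⌊ dist u v ℕ.≟ 1 ⌋

record State : Set where
  constructor st
  field
    burned    : V → Bool
    protected : V → Bool
open State public

-- Firefighter strategy (one firefighter): given the list of the pyro's
-- choices so far, the vertex protected at the current step.
FFStrategy : Set
FFStrategy = List V → V

-- Pyro's choices: c t is the burned vertex chosen at step t+1.
PyroPlay : Set
PyroPlay = ℕ → V

hist : PyroPlay → ℕ → List V
hist c t = map c (upTo t)

module Game (extra : Bool) (v0 : V) (σ : FFStrategy) (c : PyroPlay) where

  initial : State
  initial = st (λ v → ⌊ v ≟V v0 ⌋) (λ _ → false)

  ffMove : ℕ → V
  ffMove t = σ (hist c t)

  afterFF : ℕ → State → State
  afterFF t s = st B' P'
    where
      P' : V → Bool
      P' v = protected s v ∨ ⌊ v ≟V ffMove t ⌋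
      B' : V → Bool
      B' v = burned s v ∨ (extra ∧ (t <ᵇ 44) ∧ ⌊ dist v0 v ℕ.≟ suc t ⌋ ∧ not (P' v))

  -- full step t+1: firefighter move, then pyro chooses c t and burns its
  -- unburned unprotected neighbours (nothing new burns if c t is not burned;
  -- such plays are excluded by the validity hypothesis below)
  step : ℕ → State → State
  step t s = st B'' (protected m)
    where
      m = afterFF t s
      B'' : V → Bool
      B'' v = burned m v ∨ (burned m (c t) ∧ adjᵇ (c t) v ∧ not (protected m v))

  pos : ℕ → State
  pos zero = initial
  pos (suc t) = step t (pos t)

  PyroValid : ℕ → Set
  PyroValid t = burned (afterFF t (pos t)) (c t) ≡ true

  FFLegal : ℕ → Set
  FFLegal t = burned (pos t) (ffMove t) ≡ false × protected (pos t) (ffMove t) ≡ false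

  FFAt48 : ℕ → Set
  FFAt48 t = dist v0 (ffMove t) ≡ 48 ⊎ (∀ v → dist v0 v ≡ 48 → protected (pos t) v ≡ true)

Prevents48 : Bool → V → FFStrategy → Set
Prevents48 extra v0 σ =
  ∀ (c : PyroPlay) (t : ℕ) → (∀ i → i < t → Game.PyroValid extra v0 σ c i) →
    Game.FFLegal extra v0 σ c t × Game.FFAt48 extra v0 σ c t ×
    (∀ v → dist v0 v ≡ 48 → burned (Game.pos extra v0 σ c t) v ≡ false)

Contains : V → FFStrategy → Set
Contains v0 σ =
  ∀ (c : PyroPlay) → (∀ i → Game.PyroValid false v0 σ c i) →
    (∀ t → Game.FFLegal false v0 σ c t) ×
    ¬ ¬ (∃[ T ] ∀ t → T ≤ t → ∀ v → burned (Game.pos false v0 σ c t) v ≡ burned (Game.pos false v0 σ c T) v)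

{-# OPTIONS --safe #-}
-- The firefighter protects vertices of the ring at distance 48 while any is unprotected. During
-- the first 44 steps the fire stays within distance 44 (even with the extra burning), and she
-- protects a prefix of the ring containing every ring vertex within distance 4 of an axis. From
-- then on she maintains the invariant that every burning vertex x at distance 48 − k, 1 ≤ k ≤ 4,
-- is k-safe (`safe`): the fire spreading outward from x can be kept off the ring with one
-- protection per step. When the pyro spreads from x she answers with the first ring vertex that
-- restores this for the new fires. Outward spreading preserves the invariant by the definition of
-- safety; inward spreading, and the 4-safety of all vertices at distance 44 once the near-axis
-- ring vertices are protected, are finite facts checked by evaluation. So the ring never burns.
-- The standard game burns no more than the extended one, so its burned set grows monotonically
-- inside the ball of radius 47, hence (up to double negation) becomes constant. Translation moves
-- everything from the origin to an arbitrary start vertex.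
module Submission where

open import Defs
open import Data.Bool using (Bool)
open import Data.Product using (_×_; ∃-syntax)

open import Data.Bool using (true; false; T; _∧_; _∨_; not; if_then_else_)
open import Data.Bool.ListAction using (all; any)
open import Data.Bool.Properties using (T-∨; T-∧; T-≡; T?; ∨-comm)
open import Data.Empty using (⊥-elim)
open import Data.Integer as ℤ using (ℤ; +_; -[1+_]; ∣_∣)
import Data.Integer.Properties as ℤₚ
open import Data.Integer.Solver using (module +-*-Solver)
open import Data.List using (List; []; _∷_; _∷ʳ_; _++_; [_]; map; concatMap; filter; foldl; upTo; take; length)
open import Data.List.Extrema.Nat using (max; ⊥≤max; v≤max⁺)
open import Data.List.Membership.Propositional using (_∈_; _∉_; lose; find)
open import Data.List.Membership.Propositional.Properties
  using (∈-concatMap⁺; ∈-concatMap⁻; ∈-upTo⁺; ∈-upTo⁻; ∈-filter⁺; ∈-filter⁻; ∈-map⁺; ∈-++⁺ʳ; ∈-++⁻)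
import Data.List.Properties as Listₚ
import Data.List.Relation.Unary.All as All
open import Data.List.Relation.Unary.All.Properties using (all⁺; all⁻)
import Data.List.Relation.Unary.Any as Any
open import Data.List.Relation.Unary.Any using (here; there)
open import Data.List.Relation.Unary.Any.Properties using (any⁺; any⁻)
open import Data.Nat as ℕ
  using (ℕ; zero; suc; _+_; _∸_; _⊔_; _≤_; _<_; _≤ᵇ_; _<ᵇ_; _≟_; _≤?_; _<?_; z≤n; s≤s)
import Data.Nat.Properties as ℕₚ
open import Data.Product using (_,_; proj₁; proj₂; uncurry)
open import Data.Product.Properties using (,-injective)
open import Data.Sum as Sum using (_⊎_; inj₁; inj₂; [_,_]′)
open import Function using (_∘_; Equivalence)
open import Relation.Binary using (DecidableEquality)
open import Relation.Binary.PropositionalEquality hiding ([_])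
open import Relation.Nullary using (¬_; Dec; yes; no; contradiction)
open import Relation.Nullary.Decidable using (⌊_⌋; does; toWitness; map′; _×-dec_; isYes≗does)
open import Relation.Nullary.Negation using (¬¬-map)

open Equivalence using (to; from)

¬T⇒≡false : ∀ {b} → ¬ T b → b ≡ false
¬T⇒≡false {false} _  = refl
¬T⇒≡false {true}  ¬t = contradiction _ ¬t

T-not : ∀ {b} → T (not b) → ¬ T b
T-not {false} _ ()

≡-on-support : ∀ {x y : Bool} {P : Set} → (T x → P) → (T y → P) → (P → x ≡ y) → x ≡ y
≡-on-support {false} {false} _ _ _  = refl
≡-on-support {true}          p _ eq = eq (p _)
≡-on-support {false} {true}  _ p eq = eq (p _)

∨-mono : ∀ {a b c d} → (T a → T c) → (T b → T d) → T (a ∨ b) → T (c ∨ d)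
∨-mono f g = from T-∨ ∘ Sum.map f g ∘ to T-∨

all-mono : ∀ {A : Set} {p q : A → Bool} xs → (∀ {x} → T (p x) → T (q x)) → T (all p xs) → T (all q xs)
all-mono xs f = all⁻ _ ∘ All.map f ∘ all⁺ _ xs

any-mono : ∀ {A : Set} {p q : A → Bool} xs → (∀ {x} → T (p x) → T (q x)) → T (any p xs) → T (any q xs)
any-mono xs f = any⁺ _ ∘ Any.map f ∘ any⁻ _ xs

all-∈ : ∀ {A : Set} (p : A → Bool) {xs x} → T (all p xs) → x ∈ xs → T (p x)
all-∈ p {xs} h = All.lookup (all⁺ p xs h)

all≡true-∈ : ∀ {A : Set} (p : A → Bool) xs {x} → all p xs ≡ true → x ∈ xs → T (p x)
all≡true-∈ p xs h = all-∈ p (from T-≡ h)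

does-sound : ∀ {A : Set} (a? : Dec A) → T (does a?) → A
does-sound (yes a) _ = a

⌊⌋-cong : ∀ {A B : Set} → (A → B) → (B → A) → (a? : Dec A) (b? : Dec B) → ⌊ a? ⌋ ≡ ⌊ b? ⌋
⌊⌋-cong _   _   (yes _) (yes _) = refl
⌊⌋-cong _   _   (no  _) (no  _) = refl
⌊⌋-cong A→B _   (yes a) (no ¬b) = contradiction (A→B a) ¬b
⌊⌋-cong _   B→A (no ¬a) (yes b) = contradiction (B→A b) ¬a

∈-take-++ : ∀ {A : Set} {x : A} n xs ys → length xs ≤ n → x ∈ xs → x ∈ take n (xs ++ ys)
∈-take-++ (suc n) (x ∷ xs) ys _          (here refl) = here refl
∈-take-++ (suc n) (y ∷ xs) ys (s≤s len≤) (there x∈)  = there (∈-take-++ n xs ys len≤ x∈)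

-- Grid geometry

‖_‖ : V → ℕ
‖ a , b ‖ = ∣ a ∣ + ∣ b ∣

origin : V
origin = (+ 0 , + 0)

dist-origin : ∀ v → dist origin v ≡ ‖ v ‖
dist-origin (a , b) = cong₂ _+_ (∣0-i∣≡∣i∣ a) (∣0-i∣≡∣i∣ b)
  where
  ∣0-i∣≡∣i∣ : ∀ i → ∣ + 0 ℤ.- i ∣ ≡ ∣ i ∣
  ∣0-i∣≡∣i∣ i = trans (cong ∣_∣ (ℤₚ.+-identityˡ (ℤ.- i))) (ℤₚ.∣-i∣≡∣i∣ i)

_+ᵥ_ : V → V → V
(a , b) +ᵥ (c , d) = (a ℤ.+ c , b ℤ.+ d)

_-ᵥ_ : V → V → V
(a , b) -ᵥ (c , d) = (a ℤ.- c , b ℤ.- d)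

neighbours : V → List V
neighbours (a , b) = (ℤ.suc a , b) ∷ (ℤ.pred a , b) ∷ (a , ℤ.suc b) ∷ (a , ℤ.pred b) ∷ []

OffByOne : ℕ → ℕ → Set
OffByOne m n = n ≡ suc m ⊎ suc n ≡ m

offByOne-+ˡ : ∀ k {m n} → OffByOne m n → OffByOne (k + m) (k + n)
offByOne-+ˡ k {m} {n} = Sum.map (λ e → trans (cong (k ℕ.+_) e) (ℕₚ.+-suc k m))
                                (λ e → trans (sym (ℕₚ.+-suc k n)) (cong (k ℕ.+_) e))

offByOne-+ʳ : ∀ k {m n} → OffByOne m n → OffByOne (m + k) (n + k)
offByOne-+ʳ k = Sum.map (cong (ℕ._+ k)) (cong (ℕ._+ k))

offByOne-≤ : ∀ {m n} → OffByOne m n → n ≤ suc m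
offByOne-≤ (inj₁ refl) = ℕₚ.≤-refl
offByOne-≤ (inj₂ refl) = ℕₚ.m≤n+m _ 2

∣suc∣-offByOne : ∀ i → OffByOne ∣ i ∣ ∣ ℤ.suc i ∣
∣suc∣-offByOne (+ n)        = inj₁ refl
∣suc∣-offByOne -[1+ zero ]  = inj₂ refl
∣suc∣-offByOne -[1+ suc n ] = inj₂ refl

∣pred∣-offByOne : ∀ i → OffByOne ∣ i ∣ ∣ ℤ.pred i ∣
∣pred∣-offByOne (+ zero)  = inj₁ refl
∣pred∣-offByOne (+ suc n) = inj₂ refl
∣pred∣-offByOne -[1+ n ]  = inj₁ refl

neighbour-offByOne : ∀ {u v} → v ∈ neighbours u → OffByOne ‖ u ‖ ‖ v ‖
neighbour-offByOne {a , b} (here refl)                         = offByOne-+ʳ ∣ b ∣ (∣suc∣-offByOne a)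
neighbour-offByOne {a , b} (there (here refl))                 = offByOne-+ʳ ∣ b ∣ (∣pred∣-offByOne a)
neighbour-offByOne {a , b} (there (there (here refl)))         = offByOne-+ˡ ∣ a ∣ (∣suc∣-offByOne b)
neighbour-offByOne {a , b} (there (there (there (here refl)))) = offByOne-+ˡ ∣ a ∣ (∣pred∣-offByOne b)

m+n≡1 : ∀ m n → m + n ≡ 1 → (m ≡ 0 × n ≡ 1) ⊎ (m ≡ 1 × n ≡ 0)
m+n≡1 zero          n       e = inj₁ (refl , e)
m+n≡1 (suc zero)    zero    _ = inj₂ (refl , refl)
m+n≡1 (suc zero)    (suc n) ()
m+n≡1 (suc (suc m)) n       ()

∣i-j∣≡0⇒j≡i : ∀ i j → ∣ i ℤ.- j ∣ ≡ 0 → j ≡ i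
∣i-j∣≡0⇒j≡i i j e = sym (ℤₚ.i-j≡0⇒i≡j i j (ℤₚ.∣i∣≡0⇒i≡0 e))

∣i-j∣≡1⇒j≡i∓1 : ∀ i j → ∣ i ℤ.- j ∣ ≡ 1 → j ≡ ℤ.pred i ⊎ j ≡ ℤ.suc i
∣i-j∣≡1⇒j≡i∓1 i j e with i ℤ.- j | j≡-[i-j]+i
  where
  open +-*-Solver
  j≡-[i-j]+i : j ≡ ℤ.- (i ℤ.- j) ℤ.+ i
  j≡-[i-j]+i = solve 2 (λ i j → j := :- (i :- j) :+ i) refl i j
∣i-j∣≡1⇒j≡i∓1 i j refl | + 1         | j≡ = inj₁ j≡
∣i-j∣≡1⇒j≡i∓1 i j refl | -[1+ zero ] | j≡ = inj₂ j≡

adjacent⇒neighbour : ∀ {u v} → T (adjᵇ u v) → v ∈ neighbours u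
adjacent⇒neighbour {a , b} {c , d} adj with m+n≡1 ∣ a ℤ.- c ∣ ∣ b ℤ.- d ∣ (toWitness adj)
... | inj₁ (e₁ , e₂) with ∣i-j∣≡0⇒j≡i a c e₁ | ∣i-j∣≡1⇒j≡i∓1 b d e₂
...   | refl | inj₁ refl = there (there (there (here refl)))
...   | refl | inj₂ refl = there (there (here refl))
adjacent⇒neighbour {a , b} {c , d} adj
  | inj₂ (e₁ , e₂) with ∣i-j∣≡1⇒j≡i∓1 a c e₁ | ∣i-j∣≡0⇒j≡i b d e₂
...   | inj₁ refl | refl = there (here refl)
...   | inj₂ refl | refl = here refl

quadrants : ℕ → ℕ → List V
quadrants i j = (+ i , + j) ∷ (ℤ.- + i , + j) ∷ (+ i , ℤ.- + j) ∷ (ℤ.- + i , ℤ.- + j) ∷ []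

sphere : ℕ → List V
sphere n = concatMap (λ i → quadrants i (n ∸ i)) (upTo (suc n))

∈-quadrants : ∀ a b → (a , b) ∈ quadrants ∣ a ∣ ∣ b ∣
∈-quadrants (+ i)    (+ j)    = here refl
∈-quadrants -[1+ i ] (+ j)    = there (here refl)
∈-quadrants (+ i)    -[1+ j ] = there (there (here refl))
∈-quadrants -[1+ i ] -[1+ j ] = there (there (there (here refl)))

quadrants-norm : ∀ {i j v} → v ∈ quadrants i j → ‖ v ‖ ≡ i + j
quadrants-norm         (here refl)                         = refl
quadrants-norm {i} {j} (there (here refl))                 = cong (ℕ._+ j) (ℤₚ.∣-i∣≡∣i∣ (+ i))
quadrants-norm {i} {j} (there (there (here refl)))         = cong (i ℕ.+_) (ℤₚ.∣-i∣≡∣i∣ (+ j))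
quadrants-norm {i} {j} (there (there (there (here refl)))) =
  cong₂ _+_ (ℤₚ.∣-i∣≡∣i∣ (+ i)) (ℤₚ.∣-i∣≡∣i∣ (+ j))

∈-sphere : ∀ v → v ∈ sphere ‖ v ‖
∈-sphere (a , b) =
  ∈-concatMap⁺ (λ i → quadrants i (‖ a , b ‖ ∸ i)) (lose (∈-upTo⁺ (s≤s (ℕₚ.m≤m+n ∣ a ∣ ∣ b ∣)))
    (subst (λ j → (a , b) ∈ quadrants ∣ a ∣ j) (sym (ℕₚ.m+n∸m≡n ∣ a ∣ ∣ b ∣)) (∈-quadrants a b)))

on-sphere : ∀ x {n} → ‖ x ‖ ≡ n → x ∈ sphere n
on-sphere x refl = ∈-sphere x

sphere-norm : ∀ {n v} → v ∈ sphere n → ‖ v ‖ ≡ n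
sphere-norm {n} v∈ with find (∈-concatMap⁻ (λ i → quadrants i (n ∸ i)) {xs = upTo (suc n)} v∈)
... | i , i∈ , v∈quadrants = trans (quadrants-norm v∈quadrants) (ℕₚ.m+[n∸m]≡n (ℕₚ.≤-pred (∈-upTo⁻ i∈)))

ball : List V
ball = concatMap sphere (upTo 48)

∈-ball : ∀ v → ‖ v ‖ ≤ 47 → v ∈ ball
∈-ball v ≤47 = ∈-concatMap⁺ sphere (lose (∈-upTo⁺ (s≤s ≤47)) (∈-sphere v))

band : ∀ n → n ≤ 43 ⊎ ∃[ k ] n ≡ 44 + k
band n with n ≤? 43
... | yes ≤43 = inj₁ ≤43
... | no  ≰43 = inj₂ (n ∸ 44 , sym (ℕₚ.m+[n∸m]≡n (ℕₚ.≰⇒> ≰43)))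

-- Look-ahead safety

-- Evaluates faster than `_≟V_`, which matters for the certificates below.
_≟ᵥ_ : DecidableEquality V
(a , b) ≟ᵥ (c , d) = map′ (uncurry (cong₂ _,_)) ,-injective ((a ℤ.≟ c) ×-dec (b ℤ.≟ d))

open import Data.List.Membership.DecPropositional _≟ᵥ_ using (_∈?_)

_⊆ᵇ_ : (V → Bool) → (V → Bool) → Set
P ⊆ᵇ Q = ∀ {u} → T (P u) → T (Q u)

member : List V → V → Bool
member M u = does (u ∈? M)

insert : V → (V → Bool) → V → Bool
insert p P u = does (u ≟ᵥ p) ∨ P u

extend : List V → (V → Bool) → V → Bool
extend L P u = member L u ∨ P u

member⁺ : ∀ M {u} → u ∈ M → T (member M u)
member⁺ M {u} u∈ with u ∈? M
... | yes _  = _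
... | no u∉ = u∉ u∈

member⁻ : ∀ M {u} → T (member M u) → u ∈ M
member⁻ M {u} t with u ∈? M
... | yes u∈ = u∈

⊆-insert : ∀ p {P} → P ⊆ᵇ insert p P
⊆-insert p {P} {u} = from T-∨ ∘ inj₂

insert-⊆ : ∀ p {P} → T (P p) → insert p P ⊆ᵇ P
insert-⊆ p Pp {u} t with to T-∨ t
... | inj₁ u≟p with refl ← does-sound (u ≟ᵥ p) u≟p = Pp
... | inj₂ Pu = Pu

insert-mono : ∀ p {P Q} → P ⊆ᵇ Q → insert p P ⊆ᵇ insert p Q
insert-mono p P⊆Q {u} = ∨-mono (λ e → e) (P⊆Q {u})

extend-⊆ : ∀ L {P Q} → (∀ {u} → u ∈ L → T (Q u)) → P ⊆ᵇ Q → extend L P ⊆ᵇ Q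
extend-⊆ L L⊆Q P⊆Q {u} t with to T-∨ t
... | inj₁ u∈L = L⊆Q (member⁻ L u∈L)
... | inj₂ Pu  = P⊆Q Pu

children : V → List V
children x = filter (λ v → ‖ v ‖ ≟ suc ‖ x ‖) (neighbours x)

parents : V → List V
parents x = filter (λ v → suc ‖ v ‖ ≟ ‖ x ‖) (neighbours x)

grandchildren : V → List V
grandchildren x = concatMap children (children x)

∈-children : ∀ x {v} → v ∈ neighbours x → ‖ v ‖ ≡ suc ‖ x ‖ → v ∈ children x
∈-children x = ∈-filter⁺ (λ v → ‖ v ‖ ≟ suc ‖ x ‖)

∈-parents : ∀ x {v} → v ∈ neighbours x → suc ‖ v ‖ ≡ ‖ x ‖ → v ∈ parents x
∈-parents x = ∈-filter⁺ (λ v → suc ‖ v ‖ ≟ ‖ x ‖)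

children-norm : ∀ x {v} → v ∈ children x → ‖ v ‖ ≡ suc ‖ x ‖
children-norm x v∈ = proj₂ (∈-filter⁻ (λ v → ‖ v ‖ ≟ suc ‖ x ‖) {xs = neighbours x} v∈)

parents-norm : ∀ x {v} → v ∈ parents x → suc ‖ v ‖ ≡ ‖ x ‖
parents-norm x v∈ = proj₂ (∈-filter⁻ (λ v → suc ‖ v ‖ ≟ ‖ x ‖) {xs = neighbours x} v∈)

candidates : V → ℕ → List V
candidates x k = filter (λ r → ‖ r ‖ ≟ 48) (map (x +ᵥ_) (sphere k))

-- `safe k x P`: x is at distance 48 − k, P is protected and the pyro may spread from x. As long as
-- the fire moves outward from x, one protection per step keeps it off the ring: for k = 1 the ring
-- neighbours of x are already protected; for k ≥ 2, after the spread from x, protecting one ring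
-- vertex at distance k from x (or nothing) makes every child of x (k − 1)-safe.
safe : ℕ → V → (V → Bool) → Bool
safeChildren : ℕ → V → (V → Bool) → Bool
safe zero          x P = false
safe (suc zero)    x P = all P (children x)
safe (suc (suc k)) x P =
  safeChildren (suc k) x P ∨ any (λ p → safeChildren (suc k) x (insert p P)) (candidates x (suc (suc k)))
safeChildren k x P = all (λ m → safe k m P) (children x)

safe-mono : ∀ k x {P Q} → P ⊆ᵇ Q → T (safe k x P) → T (safe k x Q)
safeChildren-mono : ∀ k x {P Q} → P ⊆ᵇ Q → T (safeChildren k x P) → T (safeChildren k x Q)
safe-mono (suc zero)    x P⊆Q = all-mono (children x) P⊆Q
safe-mono (suc (suc k)) x {P} {Q} P⊆Q =
  ∨-mono (safeChildren-mono (suc k) x P⊆Q)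
         (any-mono (candidates x (suc (suc k))) (λ {p} → safeChildren-mono (suc k) x (insert-mono p {P} {Q} P⊆Q)))
safeChildren-mono k x P⊆Q = all-mono (children x) (safe-mono k _ P⊆Q)

nearAxis : V → Bool
nearAxis (a , b) = (∣ a ∣ ≤ᵇ 4) ∨ (∣ b ∣ ≤ᵇ 4)

opening : V → Bool
opening v = (‖ v ‖ ℕ.≡ᵇ 48) ∧ nearAxis v

parentsSafe : ℕ → (V → List V) → V → Bool
parentsSafe k known x = all (λ v → safe k v (extend (known x) opening)) (parents x)

-- Evaluated by the type checker. Stated with `≡ true` rather than `T`: checking a term against a
-- closed type `T b` makes Agda evaluate b all over again.
all-safe-at44 : all (λ x → safe 4 x opening) (sphere 44) ≡ true
all-safe-at44 = refl

all-safe-parents46 : all (parentsSafe 3 grandchildren) (sphere 46) ≡ true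
all-safe-parents46 = refl

all-safe-parents47 : all (parentsSafe 2 children) (sphere 47) ≡ true
all-safe-parents47 = refl

safe-at44 : ∀ x → ‖ x ‖ ≡ 44 → T (safe 4 x opening)
safe-at44 x e = all≡true-∈ (λ x → safe 4 x opening) (sphere 44) all-safe-at44 (on-sphere x e)

safe-parent46 : ∀ x {v} → ‖ x ‖ ≡ 46 → v ∈ parents x → T (safe 3 v (extend (grandchildren x) opening))
safe-parent46 x e =
  all-∈ (λ v → safe 3 v (extend (grandchildren x) opening)) {parents x}
    (all≡true-∈ (parentsSafe 3 grandchildren) (sphere 46) all-safe-parents46 (on-sphere x e))

safe-parent47 : ∀ x {v} → ‖ x ‖ ≡ 47 → v ∈ parents x → T (safe 2 v (extend (children x) opening))
safe-parent47 x e =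
  all-∈ (λ v → safe 2 v (extend (children x) opening)) {parents x}
    (all≡true-∈ (parentsSafe 2 children) (sphere 47) all-safe-parents47 (on-sphere x e))

depth : V → ℕ
depth v = 48 ∸ ‖ v ‖

interior : V → Bool
interior v = ‖ v ‖ ≤ᵇ 43

safeAt : V → (V → Bool) → Bool
safeAt v P = interior v ∨ safe (depth v) v P

safeAt-mono : ∀ v {P Q} → P ⊆ᵇ Q → T (safeAt v P) → T (safeAt v Q)
safeAt-mono v P⊆Q = ∨-mono (λ i → i) (safe-mono (depth v) v P⊆Q)

safeAt⁺ : ∀ v {P} → T (safe (depth v) v P) → T (safeAt v P)
safeAt⁺ v = from T-∨ ∘ inj₂

safeAt⁻ : ∀ v {P} → 43 < ‖ v ‖ → T (safeAt v P) → T (safe (depth v) v P)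
safeAt⁻ v 43< h with to T-∨ h
... | inj₁ i = contradiction (ℕₚ.≤ᵇ⇒≤ ‖ v ‖ 43 i) (ℕₚ.<⇒≱ 43<)
... | inj₂ s = s

safeAt-interior : ∀ v {P} → ‖ v ‖ ≤ 44 → opening ⊆ᵇ P → T (safeAt v P)
safeAt-interior v {P} ≤44 opening⊆P with ℕₚ.m≤n⇒m<n∨m≡n ≤44
... | inj₁ <44 = from T-∨ (inj₁ (ℕₚ.≤⇒≤ᵇ (ℕₚ.≤-pred <44)))
... | inj₂ ≡44 =
  safeAt⁺ v (subst (λ d → T (safe d v P)) (sym (cong (48 ∸_) ≡44)) (safe-mono 4 v opening⊆P (safe-at44 v ≡44)))

safeAt-bound : ∀ v {P} → T (safeAt v P) → ‖ v ‖ ≤ 47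
safeAt-bound v {P} h with 43 <? ‖ v ‖
... | no  ≮ = ℕₚ.≤-trans (ℕₚ.≮⇒≥ ≮) (ℕₚ.m≤n+m 43 4)
... | yes 43< with ‖ v ‖ ≤? 47
...   | yes ≤47 = ≤47
...   | no  ≰47 = ⊥-elim (subst (λ d → T (safe d v P)) (ℕₚ.m≤n⇒m∸n≡0 (ℕₚ.≰⇒> ≰47)) (safeAt⁻ v 43< h))

-- The strategy

firstNotIn : List V → List V → V → V
firstNotIn M []      d = d
firstNotIn M (y ∷ L) d with y ∈? M
... | yes _ = firstNotIn M L d
... | no  _ = y

firstNotIn-cases : ∀ M L d →
  (firstNotIn M L d ∈ L × firstNotIn M L d ∉ M) ⊎ (firstNotIn M L d ≡ d × (∀ {y} → y ∈ L → y ∈ M))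
firstNotIn-cases M []      d = inj₂ (refl , λ ())
firstNotIn-cases M (y ∷ L) d with y ∈? M
... | no y∉M = inj₁ (here refl , y∉M)
... | yes y∈M with firstNotIn-cases M L d
...   | inj₁ (∈L , ∉M)  = inj₁ (there ∈L , ∉M)
...   | inj₂ (≡d , L⊆M) = inj₂ (≡d , λ { (here refl) → y∈M ; (there y∈) → L⊆M y∈ })

firstNotIn-++ : ∀ M L₁ L₂ d {p} → p ∈ L₁ → p ∉ M → firstNotIn M (L₁ ++ L₂) d ∈ L₁
firstNotIn-++ M (y ∷ L₁) L₂ d p∈ p∉M with y ∈? M | p∈
... | no _    | _          = here refl
... | yes y∈M | here refl  = contradiction y∈M p∉M
... | yes _   | there p∈L₁ = there (firstNotIn-++ M L₁ L₂ d p∈L₁ p∉M)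

firstNotIn-take : ∀ M L d n → (∀ {u} → u ∈ take n L → u ∈ M) →
                  ∀ {u} → u ∈ take (suc n) L → u ∈ firstNotIn M L d ∷ M
firstNotIn-take M (y ∷ L) d n       _        (here refl) with y ∈? M
... | yes y∈M = there y∈M
... | no  _   = here refl
firstNotIn-take M (y ∷ L) d (suc n) prefix⊆M (there u∈) with y ∈? M
... | yes _   = firstNotIn-take M L d n (prefix⊆M ∘ there) u∈
... | no  y∉M = contradiction (prefix⊆M (here refl)) y∉M

improves? : (G : (V → Bool) → Bool) (M : List V) (p : V) → Dec (T (G (insert p (member M))))
improves? G M p = T? (G (insert p (member M)))

module _ (G : (V → Bool) → Bool) (G-mono : ∀ {P Q} → P ⊆ᵇ Q → T (G P) → T (G Q)) (M : List V) where

  firstNotIn-improves : ∀ C L d → T (G (member M) ∨ any (λ p → G (insert p (member M))) C) →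
                        T (G (insert (firstNotIn M (filter (improves? G M) C ++ L) d) (member M)))
  firstNotIn-improves C L d h with to T-∨ h
  ... | inj₁ g = G-mono (⊆-insert (firstNotIn M (filter (improves? G M) C ++ L) d) {member M}) g
  ... | inj₂ a with find (any⁻ _ C a)
  ...   | p , p∈C , gp with p ∈? M
  ...     | yes p∈M = G-mono (⊆-insert (firstNotIn M (filter (improves? G M) C ++ L) d) {member M})
                               (G-mono (insert-⊆ p {member M} (member⁺ M p∈M)) gp)
  ...     | no  p∉M =
    proj₂ (∈-filter⁻ (improves? G M) {xs = C} (firstNotIn-++ M _ L d (∈-filter⁺ (improves? G M) p∈C gp) p∉M))

-- Needed only once the whole ring is protected, since the firefighter must still make a legal move.
fresh : List V → V
fresh M = (+ suc (max 48 (map (∣_∣ ∘ proj₁) M)) , + 0)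

fresh-∉ : ∀ M → fresh M ∉ M
fresh-∉ M fresh∈M = ℕₚ.<-irrefl refl
  (v≤max⁺ 48 (map (∣_∣ ∘ proj₁) M) (inj₂ (lose (∈-map⁺ (∣_∣ ∘ proj₁) fresh∈M) ℕₚ.≤-refl)))

fresh-outside : ∀ M → 48 ≤ ‖ fresh M ‖
fresh-outside M =
  ℕₚ.≤-trans (⊥≤max 48 (map (∣_∣ ∘ proj₁) M)) (ℕₚ.≤-trans (ℕₚ.n≤1+n _) (ℕₚ.m≤m+n _ 0))

-- The ring vertices near the axes come first: there are 40 such entries (the four axis points
-- twice), so the first 44 moves cover all of them.
nearAxes : List V
nearAxes = filter (T? ∘ nearAxis) (sphere 48)

ring : List V
ring = nearAxes ++ sphere 48

ring-norm : ∀ {r} → r ∈ ring → ‖ r ‖ ≡ 48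
ring-norm r∈ with ∈-++⁻ nearAxes r∈
... | inj₁ r∈nearAxes = sphere-norm (proj₁ (∈-filter⁻ (T? ∘ nearAxis) r∈nearAxes))
... | inj₂ r∈sphere   = sphere-norm r∈sphere

∈-ring : ∀ r → ‖ r ‖ ≡ 48 → r ∈ ring
∈-ring r e = ∈-++⁺ʳ nearAxes (on-sphere r e)

opening⊆take44 : opening ⊆ᵇ member (take 44 ring)
opening⊆take44 {u} t with to T-∧ t
... | norm≡48 , near = member⁺ (take 44 ring)
  (∈-take-++ 44 nearAxes (sphere 48) (toWitness {a? = length nearAxes ≤? 44} _)
    (∈-filter⁺ (T? ∘ nearAxis) (on-sphere u (ℕₚ.≡ᵇ⇒≡ _ 48 norm≡48)) near))

repairsAt : ℕ → V → (V → Bool) → List V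
repairsAt (suc (suc k)) x P =
  filter (λ p → T? (safeChildren (suc k) x (insert p P))) (candidates x (suc (suc k)))
repairsAt _             x P = []

repairs : V → (V → Bool) → List V
repairs x P = if interior x then [] else repairsAt (depth x) x P

respond : V → List V → V
respond x M = firstNotIn M (repairs x (member M) ++ ring) (fresh M)

advance : List V × V → V → List V × V
advance (M , m) x = (m ∷ M , respond x (m ∷ M))

-- A strategy only sees the pyro's history, so the firefighter replays her own game: `plan h` is
-- the list of her protections so far (newest first) together with her next one.
plan : List V → List V × V
plan = foldl advance ([] , respond origin [])

strategy : FFStrategy
strategy h = proj₂ (plan h)

repairsAt-norm : ∀ d x P {r} → r ∈ repairsAt d x P → ‖ r ‖ ≡ 48
repairsAt-norm (suc (suc k)) x P r∈ =
  proj₂ (∈-filter⁻ (λ r → ‖ r ‖ ≟ 48) {xs = map (x +ᵥ_) (sphere (suc (suc k)))}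
          (proj₁ (∈-filter⁻ (λ p → T? (safeChildren (suc k) x (insert p P))) r∈)))

repairs-norm : ∀ x P {r} → r ∈ repairs x P → ‖ r ‖ ≡ 48
repairs-norm x P with interior x
... | true  = λ ()
... | false = repairsAt-norm (depth x) x P

respond-interior : ∀ x M → T (interior x) → respond x M ≡ firstNotIn M ring (fresh M)
respond-interior x M i =
  cong (λ b → firstNotIn M ((if b then [] else repairsAt (depth x) x (member M)) ++ ring) (fresh M)) (to T-≡ i)

respond-cases : ∀ x M →
  (‖ respond x M ‖ ≡ 48 × respond x M ∉ M) ⊎ (respond x M ≡ fresh M × (∀ {r} → r ∈ ring → r ∈ M))
respond-cases x M with firstNotIn-cases M (repairs x (member M) ++ ring) (fresh M)
... | inj₁ (r∈ , r∉M) =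
  inj₁ ([ repairs-norm x (member M) , ring-norm ]′ (∈-++⁻ (repairs x (member M)) r∈) , r∉M)
... | inj₂ (≡fresh , L⊆M) = inj₂ (≡fresh , L⊆M ∘ ∈-++⁺ʳ (repairs x (member M)))

respond-∉ : ∀ x M → respond x M ∉ M
respond-∉ x M with respond-cases x M
... | inj₁ (_ , r∉M)    = r∉M
... | inj₂ (≡fresh , _) = subst (_∉ M) (sym ≡fresh) (fresh-∉ M)

respond-outside : ∀ x M → 48 ≤ ‖ respond x M ‖
respond-outside x M with respond-cases x M
... | inj₁ (≡48 , _)    = ℕₚ.≤-reflexive (sym ≡48)
... | inj₂ (≡fresh , _) = subst (λ r → 48 ≤ ‖ r ‖) (sym ≡fresh) (fresh-outside M)

respond-repairs : ∀ {k} x M → ¬ T (interior x) → depth x ≡ suc (suc k) →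
  T (safe (suc (suc k)) x (member M)) → T (safeChildren (suc k) x (member (respond x M ∷ M)))
respond-repairs {k} x M ¬interior depth≡ x-safe =
  subst (λ L → T (safeChildren (suc k) x (insert (firstNotIn M (L ++ ring) (fresh M)) (member M)))) (sym repairs≡)
    (firstNotIn-improves (safeChildren (suc k) x) (safeChildren-mono (suc k) x) M
                         (candidates x (suc (suc k))) ring (fresh M) x-safe)
  where
  repairs≡ : repairs x (member M) ≡ filter (improves? (safeChildren (suc k) x) M) (candidates x (suc (suc k)))
  repairs≡ = trans (cong (λ b → if b then [] else repairsAt (depth x) x (member M)) (¬T⇒≡false ¬interior))
                   (cong (λ d → repairsAt d x (member M)) depth≡)

-- Propagation of safety

module Spread (M : List V) (opening⊆M : opening ⊆ᵇ member M) (x : V) (x-safe : T (safeAt x (member M))) where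

  P P′ : V → Bool
  P  = member M
  P′ = member (respond x M ∷ M)

  P⊆P′ : P ⊆ᵇ P′
  P⊆P′ = ⊆-insert (respond x M) {P}

  opening⊆P′ : opening ⊆ᵇ P′
  opening⊆P′ = P⊆P′ ∘ opening⊆M

  43<x : ∀ {k} → ‖ x ‖ ≡ 44 + k → 43 < ‖ x ‖
  43<x {k} e = subst (43 <_) (sym e) (s≤s (ℕₚ.m≤m+n 43 k))

  ¬interior : 43 < ‖ x ‖ → ¬ T (interior x)
  ¬interior 43< i = ℕₚ.<⇒≱ 43< (ℕₚ.≤ᵇ⇒≤ ‖ x ‖ 43 i)

  safe-x : ∀ {k} → ‖ x ‖ ≡ 44 + k → T (safe (4 ∸ k) x P)
  safe-x e = subst (λ d → T (safe d x P)) (cong (48 ∸_) e) (safeAt⁻ x (43<x e) x-safe)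

  outward : ∀ {j} → 43 < ‖ x ‖ → depth x ≡ suc (suc j) → ∀ {v} → v ∈ children x → T (safeAt v P′)
  outward {j} 43< depth≡ {v} v∈ =
    safeAt⁺ v (subst (λ d → T (safe d v P′)) (sym depth-v) (all-∈ (λ m → safe (suc j) m P′) children-safe v∈))
    where
    children-safe : T (safeChildren (suc j) x P′)
    children-safe =
      respond-repairs x M (¬interior 43<) depth≡ (subst (λ d → T (safe d x P)) depth≡ (safeAt⁻ x 43< x-safe))
    depth-v : depth v ≡ suc j
    depth-v = begin
      48 ∸ ‖ v ‖         ≡⟨ cong (48 ∸_) (children-norm x v∈) ⟩
      48 ∸ suc ‖ x ‖     ≡⟨ ℕₚ.pred[m∸n]≡m∸[1+n] 48 ‖ x ‖ ⟨
      ℕ.pred (depth x)   ≡⟨ cong ℕ.pred depth≡ ⟩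
      suc j              ∎
      where open ≡-Reasoning

  inward46 : ‖ x ‖ ≡ 46 → ∀ {v} → v ∈ parents x → T (safeAt v P′)
  inward46 e {v} v∈ =
    safeAt⁺ v (subst (λ d → T (safe d v P′)) (cong (48 ∸_) (sym ‖v‖≡45))
                     (safe-mono 3 v (extend-⊆ (grandchildren x) grandchildren⊆P′ opening⊆P′) (safe-parent46 x e v∈)))
    where
    ‖v‖≡45 : ‖ v ‖ ≡ 45
    ‖v‖≡45 = ℕₚ.suc-injective (trans (parents-norm x v∈) e)
    children-safe : T (safeChildren 1 x P′)
    children-safe = respond-repairs x M (¬interior (43<x e)) (cong (48 ∸_) e) (safe-x e)
    grandchildren⊆P′ : ∀ {u} → u ∈ grandchildren x → T (P′ u)
    grandchildren⊆P′ u∈ with find (∈-concatMap⁻ children {xs = children x} u∈)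
    ... | y , y∈ , u∈children-y = all-∈ P′ (all-∈ (λ m → safe 1 m P′) children-safe y∈) u∈children-y

  inward47 : ‖ x ‖ ≡ 47 → ∀ {v} → v ∈ parents x → T (safeAt v P′)
  inward47 e {v} v∈ =
    safeAt⁺ v (subst (λ d → T (safe d v P′)) (cong (48 ∸_) (sym ‖v‖≡46))
                     (safe-mono 2 v (extend-⊆ (children x) (P⊆P′ ∘ all-∈ P (safe-x e)) opening⊆P′)
                                    (safe-parent47 x e v∈)))
    where
    ‖v‖≡46 : ‖ v ‖ ≡ 46
    ‖v‖≡46 = ℕₚ.suc-injective (trans (parents-norm x v∈) e)

  neighbour-safe : ∀ {v} → v ∈ neighbours x → ¬ T (P v) → T (safeAt v P′)
  neighbour-safe {v} v∈ v∉P with band ‖ x ‖ | neighbour-offByOne v∈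
  ... | inj₁ ≤43     | off      = safeAt-interior v (ℕₚ.≤-trans (offByOne-≤ off) (s≤s ≤43)) opening⊆P′
  ... | inj₂ (0 , e) | inj₁ out = outward (43<x e) (cong (48 ∸_) e) (∈-children x v∈ out)
  ... | inj₂ (1 , e) | inj₁ out = outward (43<x e) (cong (48 ∸_) e) (∈-children x v∈ out)
  ... | inj₂ (2 , e) | inj₁ out = outward (43<x e) (cong (48 ∸_) e) (∈-children x v∈ out)
  ... | inj₂ (3 , e) | inj₁ out = contradiction (all-∈ P (safe-x e) (∈-children x v∈ out)) v∉P
  ... | inj₂ (0 , e) | inj₂ inw =
    safeAt-interior v (ℕₚ.m≤n⇒m≤1+n (ℕₚ.≤-pred (ℕₚ.≤-reflexive (trans inw e)))) opening⊆P′
  ... | inj₂ (1 , e) | inj₂ inw = safeAt-interior v (ℕₚ.≤-pred (ℕₚ.≤-reflexive (trans inw e))) opening⊆P′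
  ... | inj₂ (2 , e) | inj₂ inw = inward46 e (∈-parents x v∈ inw)
  ... | inj₂ (3 , e) | inj₂ inw = inward47 e (∈-parents x v∈ inw)
  ... | inj₂ (suc (suc (suc (suc k))) , e) | _ = ⊥-elim (subst (λ d → T (safe d x P)) (ℕₚ.0∸n≡0 k) (safe-x e))

-- The extended game from the origin

⌊≟V⌋≡does≟ᵥ : ∀ u v → ⌊ u ≟V v ⌋ ≡ does (u ≟ᵥ v)
⌊≟V⌋≡does≟ᵥ u v = trans (⌊⌋-cong (λ e → e) (λ e → e) (u ≟V v) (u ≟ᵥ v)) (isYes≗does (u ≟ᵥ v))

module Extended (c : PyroPlay) where
  open Game true origin strategy c

  protections : ℕ → List V
  protections t = proj₁ (plan (hist c t))

  plan-suc : ∀ t → plan (hist c (suc t)) ≡ advance (plan (hist c t)) (c t)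
  plan-suc t = trans (cong plan hist-suc) (Listₚ.foldl-∷ʳ advance _ (c t) (hist c t))
    where
    hist-suc : hist c (suc t) ≡ hist c t ∷ʳ c t
    hist-suc = trans (cong (map c) (sym (Listₚ.upTo-∷ʳ t))) (Listₚ.map-++ c (upTo t) [ t ])

  protections-suc : ∀ t → protections (suc t) ≡ ffMove t ∷ protections t
  protections-suc t = cong proj₁ {plan (hist c (suc t))} {advance (plan (hist c t)) (c t)} (plan-suc t)

  ffMove-suc : ∀ t → ffMove (suc t) ≡ respond (c t) (protections (suc t))
  ffMove-suc t = trans (cong proj₂ {plan (hist c (suc t))} {advance (plan (hist c t)) (c t)} (plan-suc t))
                       (cong (respond (c t)) (sym (protections-suc t)))

  ffMove-respond : ∀ t → ∃[ x ] ffMove t ≡ respond x (protections t)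
  ffMove-respond zero    = origin , refl
  ffMove-respond (suc t) = c t , ffMove-suc t

  protected≡member : ∀ t u → protected (pos t) u ≡ member (protections t) u
  protected≡member zero    u = refl
  protected≡member (suc t) u = begin
    protected (pos t) u ∨ ⌊ u ≟V ffMove t ⌋
      ≡⟨ cong₂ _∨_ (protected≡member t u) (⌊≟V⌋≡does≟ᵥ u (ffMove t)) ⟩
    member (protections t) u ∨ does (u ≟ᵥ ffMove t)
      ≡⟨ ∨-comm (member (protections t) u) _ ⟩
    member (ffMove t ∷ protections t) u
      ≡⟨ cong (λ M → member M u) (protections-suc t) ⟨
    member (protections (suc t)) u
      ∎
    where open ≡-Reasoning

  protections-step : ∀ t {u} → u ∈ protections t → u ∈ protections (suc t)
  protections-step t {u} u∈ = subst (u ∈_) (sym (protections-suc t)) (there u∈)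

  protections-mono : ∀ t t′ → t ≤ t′ → ∀ {u} → u ∈ protections t → u ∈ protections t′
  protections-mono t zero     z≤n u∈ = u∈
  protections-mono t (suc t′) t≤  u∈ with ℕₚ.m≤n⇒m<n∨m≡n t≤
  ... | inj₂ refl       = u∈
  ... | inj₁ (s≤s t≤t′) = protections-step t′ (protections-mono t t′ t≤t′ u∈)

  burned-afterFF : ∀ t s v → T (burned (afterFF t s) v) → T (burned s v) ⊎ (t < 44 × dist origin v ≡ suc t)
  burned-afterFF t s v h with to T-∨ h
  ... | inj₁ old   = inj₁ old
  ... | inj₂ extra with to T-∧ extra
  ...   | t<44 , rest =
    inj₂ (ℕₚ.<ᵇ⇒< t 44 t<44 ,
          toWitness {a? = dist origin v ≟ suc t} (proj₁ (to (T-∧ {⌊ dist origin v ≟ suc t ⌋}) rest)))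

  burned-step : ∀ t s v → T (burned (step t s) v) →
    T (burned (afterFF t s) v) ⊎ (T (burned (afterFF t s) (c t)) × v ∈ neighbours (c t) × ¬ T (protected (afterFF t s) v))
  burned-step t s v h with to T-∨ h
  ... | inj₁ old    = inj₁ old
  ... | inj₂ spread with to T-∧ spread
  ...   | c-burned , rest with to T-∧ rest
  ...     | adjacent , unprotected = inj₂ (c-burned , adjacent⇒neighbour adjacent , T-not unprotected)

  radius : ∀ t v → T (burned (pos t) v) → ‖ v ‖ ≤ suc t
  radius-afterFF : ∀ t v → T (burned (afterFF t (pos t)) v) → ‖ v ‖ ≤ suc t
  radius zero    v h with refl ← toWitness {a? = v ≟V origin} h = z≤n
  radius (suc t) v h with burned-step t (pos t) v h
  ... | inj₁ old                 = ℕₚ.m≤n⇒m≤1+n (radius-afterFF t v old)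
  ... | inj₂ (c-burned , v∈ , _) =
    ℕₚ.≤-trans (offByOne-≤ (neighbour-offByOne v∈)) (s≤s (radius-afterFF t (c t) c-burned))
  radius-afterFF t v h with burned-afterFF t (pos t) v h
  ... | inj₁ old         = radius t v old
  ... | inj₂ (_ , dist≡) = ℕₚ.≤-reflexive (trans (sym (dist-origin v)) dist≡)

  OpeningValid : Set
  OpeningValid = ∀ i → i < 43 → PyroValid i

  ffMove-early : ∀ t → t ≤ 43 → (∀ i → i < t → PyroValid i) →
                 ffMove t ≡ firstNotIn (protections t) ring (fresh (protections t))
  ffMove-early zero    _   _     = refl
  ffMove-early (suc t) ≤43 valid =
    trans (ffMove-suc t) (respond-interior (c t) (protections (suc t)) (ℕₚ.≤⇒≤ᵇ ‖c‖≤43))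
    where
    ‖c‖≤43 : ‖ c t ‖ ≤ 43
    ‖c‖≤43 = ℕₚ.≤-trans (radius-afterFF t (c t) (from T-≡ (valid t ℕₚ.≤-refl))) ≤43

  ring-prefix-protected : ∀ t → t ≤ 44 → OpeningValid → ∀ {u} → u ∈ take t ring → u ∈ protections t
  ring-prefix-protected (suc t) ≤44 valid {u} u∈ =
    subst (u ∈_) (sym (protections-suc t))
      (subst (λ m → u ∈ m ∷ protections t) (sym (ffMove-early t ≤43 (λ i i<t → valid i (ℕₚ.<-≤-trans i<t ≤43))))
        (firstNotIn-take (protections t) ring _ t (ring-prefix-protected t (ℕₚ.m≤n⇒m≤1+n ≤43) valid) u∈))
    where
    ≤43 : t ≤ 43
    ≤43 = ℕₚ.≤-pred ≤44

  opening-protected : ∀ t → 44 ≤ t → OpeningValid → opening ⊆ᵇ member (protections t)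
  opening-protected t 44≤t valid {u} o =
    member⁺ (protections t) {u} (protections-mono 44 t 44≤t
      (ring-prefix-protected 44 ℕₚ.≤-refl valid (member⁻ (take 44 ring) {u} (opening⊆take44 {u} o))))

  Invariant : ℕ → Set
  Invariant t = ∀ v → T (burned (afterFF t (pos t)) v) → T (safeAt v (member (protections (suc t))))

  -- Stated for any t equal to 43 rather than for the literal: at a literal time Agda unfolds the
  -- whole play when comparing types, which is prohibitively slow.
  invariant-start : ∀ t → 43 ≡ t → OpeningValid → Invariant t
  invariant-start t 43≡t valid v h =
    safeAt-interior v (subst (λ n → ‖ v ‖ ≤ suc n) (sym 43≡t) (radius-afterFF t v h))
                      (opening-protected (suc t) (ℕₚ.≤-reflexive (cong suc 43≡t)) valid)

  spread-safe : ∀ t → 43 ≤ t → OpeningValid → T (safeAt (c t) (member (protections (suc t)))) →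
                ∀ {v} → v ∈ neighbours (c t) → ¬ T (member (protections (suc t)) v) →
                T (safeAt v (member (protections (suc (suc t)))))
  spread-safe t 43≤t valid c-safe {v} v∈ v∉M =
    subst (λ M′ → T (safeAt v (member M′))) (sym protections-suc-suc)
      (Spread.neighbour-safe M (opening-protected (suc t) (s≤s 43≤t) valid) (c t) c-safe v∈ v∉M)
    where
    M = protections (suc t)
    protections-suc-suc : protections (suc (suc t)) ≡ respond (c t) M ∷ M
    protections-suc-suc = trans (protections-suc (suc t)) (cong (_∷ M) (ffMove-suc t))

  invariant-step : ∀ t → 43 ≤ t → OpeningValid → Invariant t → Invariant (suc t)
  invariant-step t 43≤t valid inv v h =
    [ (λ b → [ (safeAt-mono v step⊆ ∘ inv v) , new-fire ]′ (burned-step t (pos t) v b))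
    , (λ (1+t<44 , _) → contradiction (s≤s 43≤t) (ℕₚ.<⇒≱ 1+t<44)) ]′ (burned-afterFF (suc t) (pos (suc t)) v h)
    where
    step⊆ : member (protections (suc t)) ⊆ᵇ member (protections (suc (suc t)))
    step⊆ {u} = member⁺ (protections (suc (suc t))) {u} ∘ protections-step (suc t) ∘ member⁻ (protections (suc t)) {u}
    new-fire : T (burned (afterFF t (pos t)) (c t)) × v ∈ neighbours (c t) × ¬ T (protected (afterFF t (pos t)) v) →
               T (safeAt v (member (protections (suc (suc t)))))
    new-fire (c-burned , v∈ , unprotected) =
      spread-safe t 43≤t valid (inv (c t) c-burned) v∈ (subst (λ b → ¬ T b) (protected≡member (suc t) v) unprotected)

  invariant : OpeningValid → ∀ t → 43 ≤ t → Invariant t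
  invariant valid t 43≤t with ℕₚ.m≤n⇒m<n∨m≡n 43≤t
  ... | inj₂ 43≡t                  = invariant-start t 43≡t valid
  ... | inj₁ (s≤s {n = t′} 43≤t′) = invariant-step t′ 43≤t′ valid (invariant valid t′ 43≤t′)

  burned-bound : ∀ t → (∀ i → i < t → PyroValid i) → ∀ v → T (burned (pos t) v) → ‖ v ‖ ≤ 47
  burned-bound t valid v h with t ≤? 44
  ... | yes ≤44 = ℕₚ.≤-trans (radius t v h) (ℕₚ.≤-trans (s≤s ≤44) (ℕₚ.m≤m+n 45 2))
  ... | no  ≰44 =
    safeAt-bound v (invariant (λ i i<43 → valid i (ℕₚ.<-trans i<43 43<t)) t (ℕₚ.<⇒≤ 43<t) v (from T-∨ (inj₁ h)))
    where
    43<t : 43 < t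
    43<t = ℕₚ.<-trans (ℕₚ.n<1+n 43) (ℕₚ.≰⇒> ≰44)

  unburned-outside : ∀ t → (∀ i → i < t → PyroValid i) → ∀ v → 48 ≤ ‖ v ‖ → burned (pos t) v ≡ false
  unburned-outside t valid v 48≤ = ¬T⇒≡false (λ h → ℕₚ.<⇒≱ (s≤s (burned-bound t valid v h)) 48≤)

  ffMove-legal : ∀ t → (∀ i → i < t → PyroValid i) → FFLegal t
  ffMove-legal t valid with ffMove-respond t
  ... | x , ≡respond =
    unburned-outside t valid (ffMove t) (subst (λ m → 48 ≤ ‖ m ‖) (sym ≡respond) (respond-outside x (protections t))) ,
    trans (protected≡member t (ffMove t))
          (¬T⇒≡false λ h → respond-∉ x (protections t)
                              (subst (_∈ protections t) ≡respond (member⁻ (protections t) h)))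

  ffMove-at48 : ∀ t → FFAt48 t
  ffMove-at48 t with ffMove-respond t
  ... | x , ≡respond with respond-cases x (protections t)
  ...   | inj₁ (≡48 , _)    = inj₁ (trans (dist-origin (ffMove t)) (trans (cong ‖_‖ ≡respond) ≡48))
  ...   | inj₂ (_ , ring⊆M) = inj₂ λ v dist≡ →
    trans (protected≡member t v)
          (to T-≡ (member⁺ (protections t) (ring⊆M (∈-ring v (trans (sym (dist-origin v)) dist≡)))))

prevents-extended : Prevents48 true origin strategy
prevents-extended c t valid =
  ffMove-legal t valid , ffMove-at48 t ,
  λ v dist≡ → unburned-outside t valid v (ℕₚ.≤-reflexive (trans (sym dist≡) (dist-origin v)))
  where open Extended c

-- The standard game

module Domination (v0 : V) (σ : FFStrategy) (c : PyroPlay) where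
  module Std = Game false v0 σ c
  module Ext = Game true v0 σ c

  protected-same : ∀ t v → protected (Std.pos t) v ≡ protected (Ext.pos t) v
  protected-same zero    v = refl
  protected-same (suc t) v = cong (_∨ ⌊ v ≟V Std.ffMove t ⌋) (protected-same t v)

  burned-⊆ : ∀ t v → T (burned (Std.pos t) v) → T (burned (Ext.pos t) v)
  afterFF-⊆ : ∀ t v → T (burned (Std.afterFF t (Std.pos t)) v) → T (burned (Ext.afterFF t (Ext.pos t)) v)
  burned-⊆ zero    v b = b
  burned-⊆ (suc t) v b with to T-∨ b
  ... | inj₁ old    = from T-∨ (inj₁ (afterFF-⊆ t v old))
  ... | inj₂ spread with to T-∧ spread
  ...   | c-burned , rest =
    from T-∨ (inj₂ (from T-∧ (afterFF-⊆ t (c t) c-burned ,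
                             subst (λ p → T (adjᵇ (c t) v ∧ not p)) (protected-same (suc t) v) rest)))
  afterFF-⊆ t v b with to T-∨ b
  ... | inj₁ old = from T-∨ (inj₁ (burned-⊆ t v old))
  ... | inj₂ ()

  unburned : ∀ t v → burned (Ext.pos t) v ≡ false → burned (Std.pos t) v ≡ false
  unburned t v ext≡false = ¬T⇒≡false (λ b → subst T ext≡false (burned-⊆ t v b))

  valid-ext : ∀ i → Std.PyroValid i → Ext.PyroValid i
  valid-ext i valid = to T-≡ (afterFF-⊆ i (c i) (from T-≡ valid))

prevents-standard : ∀ v0 σ → Prevents48 true v0 σ → Prevents48 false v0 σ
prevents-standard v0 σ prevents c t valid with prevents c t (λ i i<t → valid-ext i (valid i i<t))
  where open Domination v0 σ c
... | (ff-unburned , ff-unprotected) , at48 , ring-unburned =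
  (unburned t (Std.ffMove t) ff-unburned , trans (protected-same t (Std.ffMove t)) ff-unprotected) ,
  at48-std at48 ,
  λ v dist≡ → unburned t v (ring-unburned v dist≡)
  where
  open Domination v0 σ c
  at48-std : Ext.FFAt48 t → Std.FFAt48 t
  at48-std (inj₁ dist≡)   = inj₁ dist≡
  at48-std (inj₂ ring⊆P) = inj₂ λ v dist≡ → trans (protected-same t v) (ring⊆P v dist≡)

module Stabilisation {A : Set} (B : ℕ → A → Bool) (B-mono : ∀ t a → T (B t a) → T (B (suc t) a)) where

  StableOn : (A → Set) → ℕ → Set
  StableOn S T₀ = ∀ t → T₀ ≤ t → ∀ a → S a → B t a ≡ B T₀ a

  B-mono≤ : ∀ a {t t′} → t ≤ t′ → T (B t a) → T (B t′ a)
  B-mono≤ a {t} {zero}   z≤n b = b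
  B-mono≤ a {t} {suc t′} t≤ b with ℕₚ.m≤n⇒m<n∨m≡n t≤
  ... | inj₂ refl       = b
  ... | inj₁ (s≤s t≤t′) = B-mono t′ a (B-mono≤ a t≤t′ b)

  stableOn-later : ∀ {S T₀ T₁} → T₀ ≤ T₁ → StableOn S T₀ → StableOn S T₁
  stableOn-later T₀≤T₁ stable t T₁≤t a Sa =
    trans (stable t (ℕₚ.≤-trans T₀≤T₁ T₁≤t) a Sa) (sym (stable _ T₀≤T₁ a Sa))

  stable-point : ∀ a → ¬ ¬ (∃[ T₀ ] StableOn (_≡ a) T₀)
  stable-point a unstable =
    unstable (0 , λ t _ _ → λ { refl → trans (¬T⇒≡false (never t)) (sym (¬T⇒≡false (never 0))) })
    where
    never : ∀ t → ¬ T (B t a)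
    never t b = unstable (t , λ t′ t≤t′ _ → λ { refl → trans (to T-≡ (B-mono≤ a t≤t′ b)) (sym (to T-≡ b)) })

  stable-list : ∀ L → ¬ ¬ (∃[ T₀ ] StableOn (_∈ L) T₀)
  stable-list []      unstable = unstable (0 , λ _ _ _ ())
  stable-list (a ∷ L) unstable =
    stable-point a λ (T₁ , stable₁) → stable-list L λ (T₂ , stable₂) →
      unstable (T₁ ⊔ T₂ , λ where
        t ≤t _ (here refl) → stableOn-later (ℕₚ.m≤m⊔n T₁ T₂) stable₁ t ≤t a refl
        t ≤t b (there b∈L) → stableOn-later (ℕₚ.m≤n⊔m T₁ T₂) stable₂ t ≤t b b∈L)

  eventually-constant : ∀ L → (∀ t a → T (B t a) → a ∈ L) →
                        ¬ ¬ (∃[ T₀ ] ∀ t → T₀ ≤ t → ∀ a → B t a ≡ B T₀ a)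
  eventually-constant L B⊆L = ¬¬-map (λ (T₀ , stable) → T₀ , λ t T₀≤t a →
    ≡-on-support (B⊆L t a) (B⊆L T₀ a) (stable t T₀≤t a)) (stable-list L)

contains-origin : Contains origin strategy
contains-origin c valid =
  (λ t → proj₁ (prevents-standard origin strategy prevents-extended c t (λ i _ → valid i))) ,
  Stabilisation.eventually-constant (λ t → burned (Std.pos t)) burned-mono ball burned-in-ball
  where
  open Domination origin strategy c
  burned-mono : ∀ t v → T (burned (Std.pos t) v) → T (burned (Std.pos (suc t)) v)
  burned-mono t v b = from T-∨ (inj₁ (from T-∨ (inj₁ b)))
  burned-in-ball : ∀ t v → T (burned (Std.pos t) v) → v ∈ ball
  burned-in-ball t v b = ∈-ball v (Extended.burned-bound c t (λ i _ → valid-ext i (valid i)) v (burned-⊆ t v b))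

-- Translation

translate : V → FFStrategy → FFStrategy
translate v0 σ h = v0 +ᵥ σ (map (_-ᵥ v0) h)

module _ where
  open +-*-Solver

  [v0+m]-v0≡m : ∀ v0 m → (v0 +ᵥ m) -ᵥ v0 ≡ m
  [v0+m]-v0≡m (x , y) (a , b) = cong₂ _,_ (lemma x a) (lemma y b)
    where lemma = solve 2 (λ x a → (x :+ a) :- x := a) refl

  v0+[v-v0]≡v : ∀ v0 v → v0 +ᵥ (v -ᵥ v0) ≡ v
  v0+[v-v0]≡v (x , y) (a , b) = cong₂ _,_ (lemma x a) (lemma y b)
    where lemma = solve 2 (λ x a → x :+ (a :- x) := a) refl

  dist-shift : ∀ w u v → dist (u -ᵥ w) (v -ᵥ w) ≡ dist u v
  dist-shift (x , y) (a , b) (c , d) = cong₂ _+_ (cong ∣_∣ (lemma a c x)) (cong ∣_∣ (lemma b d y))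
    where lemma = solve 3 (λ a c x → (a :- x) :- (c :- x) := a :- c) refl

  dist-origin-shift : ∀ v0 v → dist origin (v -ᵥ v0) ≡ dist v0 v
  dist-origin-shift (x , y) (a , b) = cong₂ _+_ (cong ∣_∣ (lemma x a)) (cong ∣_∣ (lemma y b))
    where lemma = solve 2 (λ x a → con (+ 0) :- (a :- x) := x :- a) refl

v-v≡origin : ∀ v → v -ᵥ v ≡ origin
v-v≡origin (x , y) = cong₂ _,_ (ℤₚ.+-inverseʳ x) (ℤₚ.+-inverseʳ y)

module Shift (extra : Bool) (v0 : V) (σ : FFStrategy) (c : PyroPlay) where

  c₀ : PyroPlay
  c₀ t = c t -ᵥ v0

  module G = Game extra v0 (translate v0 σ) c
  module H = Game extra origin σ c₀

  ffMove-shift : ∀ t → G.ffMove t -ᵥ v0 ≡ H.ffMove t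
  ffMove-shift t = trans (cong (λ h → (v0 +ᵥ σ h) -ᵥ v0) (sym (Listₚ.map-∘ (upTo t)))) ([v0+m]-v0≡m v0 (H.ffMove t))

  ≟-shift : ∀ u w → ⌊ u ≟V w ⌋ ≡ ⌊ (u -ᵥ v0) ≟V (w -ᵥ v0) ⌋
  ≟-shift u w =
    ⌊⌋-cong (cong (_-ᵥ v0)) (λ e → trans (sym (v0+[v-v0]≡v v0 u)) (trans (cong (v0 +ᵥ_) e) (v0+[v-v0]≡v v0 w)))
                        (u ≟V w) ((u -ᵥ v0) ≟V (w -ᵥ v0))

  Shifted : State → State → Set
  Shifted S S₀ = ∀ v → burned S v ≡ burned S₀ (v -ᵥ v0) × protected S v ≡ protected S₀ (v -ᵥ v0)

  shifted-afterFF : ∀ t S S₀ → Shifted S S₀ → Shifted (G.afterFF t S) (H.afterFF t S₀)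
  shifted-afterFF t S S₀ rel v =
    cong₂ _∨_ (proj₁ (rel v))
      (cong₂ (λ d p → extra ∧ (t <ᵇ 44) ∧ ⌊ d ≟ suc t ⌋ ∧ not p) (sym (dist-origin-shift v0 v)) protected≡) ,
    protected≡
    where
    protected≡ : (protected S v ∨ ⌊ v ≟V G.ffMove t ⌋) ≡ (protected S₀ (v -ᵥ v0) ∨ ⌊ (v -ᵥ v0) ≟V H.ffMove t ⌋)
    protected≡ = cong₂ _∨_ (proj₂ (rel v))
                   (trans (≟-shift v (G.ffMove t)) (cong (λ m → ⌊ (v -ᵥ v0) ≟V m ⌋) (ffMove-shift t)))

  shifted-step : ∀ t S S₀ → Shifted S S₀ → Shifted (G.step t S) (H.step t S₀)
  shifted-step t S S₀ rel v =
    cong₂ _∨_ (proj₁ (rel′ v))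
      (cong₂ _∧_ (proj₁ (rel′ (c t)))
        (cong₂ _∧_ (cong (λ d → ⌊ d ≟ 1 ⌋) (sym (dist-shift v0 (c t) v))) (cong not (proj₂ (rel′ v))))) ,
    proj₂ (rel′ v)
    where rel′ = shifted-afterFF t S S₀ rel

  shifted-pos : ∀ t → Shifted (G.pos t) (H.pos t)
  shifted-pos zero    v = trans (≟-shift v v0) (cong (λ m → ⌊ (v -ᵥ v0) ≟V m ⌋) (v-v≡origin v0)) , refl
  shifted-pos (suc t) = shifted-step t (G.pos t) (H.pos t) (shifted-pos t)

  burned-shift : ∀ t v → burned (G.pos t) v ≡ burned (H.pos t) (v -ᵥ v0)
  burned-shift t v = proj₁ (shifted-pos t v)

  valid-shift : ∀ i → G.PyroValid i → H.PyroValid i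
  valid-shift i valid = trans (sym (proj₁ (shifted-afterFF i (G.pos i) (H.pos i) (shifted-pos i) (c i)))) valid

  legal-shift : ∀ t → H.FFLegal t → G.FFLegal t
  legal-shift t (unburned , unprotected) =
    trans (burned-shift t (G.ffMove t)) (trans (cong (burned (H.pos t)) (ffMove-shift t)) unburned) ,
    trans (proj₂ (shifted-pos t (G.ffMove t))) (trans (cong (protected (H.pos t)) (ffMove-shift t)) unprotected)

  at48-shift : ∀ t → H.FFAt48 t → G.FFAt48 t
  at48-shift t (inj₁ dist≡) =
    inj₁ (trans (sym (dist-origin-shift v0 (G.ffMove t))) (trans (cong (dist origin) (ffMove-shift t)) dist≡))
  at48-shift t (inj₂ ring⊆P) =
    inj₂ λ v dist≡ → trans (proj₂ (shifted-pos t v)) (ring⊆P (v -ᵥ v0) (trans (dist-origin-shift v0 v) dist≡))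

prevents-translate : ∀ extra v0 σ → Prevents48 extra origin σ → Prevents48 extra v0 (translate v0 σ)
prevents-translate extra v0 σ prevents c t valid
  with prevents c₀ t (λ i i<t → valid-shift i (valid i i<t))
  where open Shift extra v0 σ c
... | legal , at48 , ring-unburned =
  legal-shift t legal , at48-shift t at48 ,
  λ v dist≡ → trans (burned-shift t v) (ring-unburned (v -ᵥ v0) (trans (dist-origin-shift v0 v) dist≡))
  where open Shift extra v0 σ c

contains-translate : ∀ v0 σ → Contains origin σ → Contains v0 (translate v0 σ)
contains-translate v0 σ contains c valid
  with contains c₀ (λ i → valid-shift i (valid i))
  where open Shift false v0 σ c
... | legal , stabilises =
  (λ t → legal-shift t (legal t)) ,
  ¬¬-map (λ (T₀ , stable) → T₀ , λ t T₀≤t v →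
    trans (burned-shift t v) (trans (stable t T₀≤t (v -ᵥ v0)) (sym (burned-shift T₀ v)))) stabilises
  where open Shift false v0 σ c

mainTheorem2 : ((extra : Bool) (v0 : V) → ∃[ σ ] Prevents48 extra v0 σ)
               × ((v0 : V) → ∃[ σ ] Contains v0 σ)
mainTheorem2 =
  (λ extra v0 → translate v0 strategy , prevents-translate extra v0 strategy (prevents extra)) ,
  (λ v0 → translate v0 strategy , contains-translate v0 strategy contains-origin)
  where
  prevents : ∀ extra → Prevents48 extra origin strategy
  prevents true  = prevents-extended
  prevents false = prevents-standard origin strategy prevents-extended
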